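{- Let $R=R_1\times\cdots\times R_n$ be a finite ring, where each $(R_i,\mathfrak{m}_i)$ is a (commutative, unital) local ring, ordered so that $|R_1/\mathfrak{m}_1|\le\cdots\le|R_n/\mathfrak{m}_n|$. Then $$\omega\big(Reg(\mathbb{CAY}(R))\big)=\chi\big(Reg(\mathbb{CAY}(R))\big)=|\mathfrak{m}_1|(|R_2|-|\mathfrak{m}_2|)\cdots(|R_n|-|\mathfrak{m}_n|).$$
   Context: $Z(R)$ is the set of zero-divisors of $R$ (including $0$), $Reg(R)=R\setminus Z(R)$. $\mathbb{CAY}(R)$ is the graph with vertex set $R$ in which distinct $x,y$ are adjacent iff $x-y\in Z(R)$, and $Reg(\mathbb{CAY}(R))$ is its induced subgraph on $Reg(R)$. For $n=1$ the product on the right is just $|\mathfrak{m}_1|$. -}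

module Defs where

open import Level using (0ℓ)
open import Data.Nat using (ℕ; zero; suc; _*_; _∸_; _≤_)
open import Data.Fin using (Fin; zero; suc; _<?_) renaming (_<_ to _<ᶠ_)
open import Data.Fin.Properties using (_≟_; any?; all?)
open import Data.List using (List; length; filter; allFin)
open import Data.List.Relation.Unary.All using (All)
open import Data.List.Relation.Unary.AllPairs using (AllPairs)
open import Data.Product using (Σ; ∃; _×_; _,_)
open import Relation.Nullary using (¬_; Dec; yes; no)
open import Relation.Nullary.Decidable using (¬?; _→-dec_)
open import Relation.Unary using (Pred; Decidable)
open import Relation.Binary.PropositionalEquality using (_≡_; _≢_)
open import Algebra.Structures using (IsCommutativeRing)

-- Finite commutative unital rings, with carrier Fin size (every finite
-- ring is isomorphic to one of these) and propositional equality.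

record FinCommRing : Set where
  field
    size : ℕ
    _+ᴿ_ _*ᴿ_ : Fin size → Fin size → Fin size
    -ᴿ_ : Fin size → Fin size
    0# 1# : Fin size
    isCommutativeRing : IsCommutativeRing _≡_ _+ᴿ_ _*ᴿ_ -ᴿ_ 0# 1#

open FinCommRing public

count : ∀ {k} {P : Pred (Fin k) 0ℓ} → Decidable P → ℕ
count {k} P? = length (filter P? (allFin k))

module _ (R : FinCommRing) where
  private
    _+R_ = _+ᴿ_ R
    _*R_ = _*ᴿ_ R
    -R_ = -ᴿ_ R

  IsUnit : Fin (size R) → Set
  IsUnit x = ∃ λ y → x *R y ≡ 1# R

  isUnit? : Decidable IsUnit
  isUnit? x = any? (λ y → (x *R y) ≟ 1# R)

  -- local ring: 1 ≠ 0 and the non-units form an ideal (closed under +;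
  -- closure under multiplication by ring elements is automatic)
  IsLocal : Set
  IsLocal = (1# R ≢ 0# R)
          × (∀ x y → ¬ IsUnit x → ¬ IsUnit y → ¬ IsUnit (x +R y))

  InMax : Fin (size R) → Set
  InMax x = ¬ IsUnit x

  inMax? : Decidable InMax
  inMax? x = ¬? (isUnit? x)

  maxCard : ℕ
  maxCard = count inMax?

  -- |R / 𝔪| : number of cosets x + 𝔪, counted via their least
  -- representative (x is least in its coset iff no y < x has x - y ∈ 𝔪)
  LeastRep : Fin (size R) → Set
  LeastRep x = ∀ y → y <ᶠ x → ¬ InMax (x +R (-R y))

  leastRep? : Decidable LeastRep
  leastRep? x = all? (λ y → (y <? x) →-dec ¬? (inMax? (x +R (-R y))))

  residueCard : ℕ
  residueCard = count leastRep?

module Product {n : ℕ} (R : Fin n → FinCommRing) where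

  Carrier : Set
  Carrier = (i : Fin n) → Fin (size (R i))

  _≈_ : Carrier → Carrier → Set
  x ≈ y = ∀ i → x i ≡ y i

  0ᴾ : Carrier
  0ᴾ i = 0# (R i)

  _*ᴾ_ : Carrier → Carrier → Carrier
  (x *ᴾ y) i = _*ᴿ_ (R i) (x i) (y i)

  _-ᴾ_ : Carrier → Carrier → Carrier
  (x -ᴾ y) i = _+ᴿ_ (R i) (x i) (-ᴿ_ (R i) (y i))

  -- Z(R): zero-divisors (including 0)
  ZeroDiv : Carrier → Set
  ZeroDiv x = ∃ λ y → ¬ (y ≈ 0ᴾ) × ((x *ᴾ y) ≈ 0ᴾ)

  Reg : Carrier → Set
  Reg x = ¬ ZeroDiv x

  Adj : Carrier → Carrier → Set
  Adj x y = ¬ (x ≈ y) × ZeroDiv (x -ᴾ y)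

-- Clique number and chromatic number of the induced subgraph on the
-- vertices satisfying V of a graph with adjacency E on a carrier A.
-- (E is assumed to already encode distinctness of its endpoints.)

module _ {A : Set} (V : A → Set) (E : A → A → Set) where

  IsClique : List A → Set
  IsClique xs = All V xs × AllPairs E xs

  IsCliqueNumber : ℕ → Set
  IsCliqueNumber k = (∃ λ xs → IsClique xs × length xs ≡ k)
                   × (∀ xs → IsClique xs → length xs ≤ k)

  IsProperColoring : ∀ {m} → (A → Fin m) → Set
  IsProperColoring c = ∀ x y → V x → V y → E x y → c x ≢ c y

  IsChromaticNumber : ℕ → Set
  IsChromaticNumber k = (∃ λ (c : A → Fin k) → IsProperColoring c)
                      × (∀ m (c : A → Fin m) → IsProperColoring c → k ≤ m)

∏ : ∀ {n} → (Fin n → ℕ) → ℕ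
∏ {zero} f = 1
∏ {suc n} f = f zero * ∏ (λ i → f (suc i))

module Submission where

-- The regular elements of R = R₀ × ⋯ × Rₙ are the tuples of units, and two of them are
-- adjacent in CAY(R) iff they are congruent modulo 𝔪ᵢ in some coordinate i.  The tuples
-- (1 + m, u₁, …, uₙ) with m ∈ 𝔪₀ and units uᵢ form a clique of the claimed size, since any two
-- of them are congruent modulo 𝔪₀.  For a colouring with as many colours, write
-- x₀ = rep x₀ + offset x₀ with rep x₀ the least representative of the residue class of x₀, so
-- offset x₀ ∈ 𝔪₀.  As |R₀/𝔪₀| ≤ |Rᵢ/𝔪ᵢ|, the unit classes of R₀ embed into unit representatives
-- τᵢ of classes of Rᵢ.  Colour a regular x by offset x₀ together with the units xᵢ·τᵢ(x₀): if
-- adjacent x, y got the same colour, a congruence in any coordinate forces x₀ ≡ y₀ mod 𝔪₀,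
-- hence x₀ = y₀, hence x = y.

open import Defs hiding (0#; 1#)
open import Level using (0ℓ)
open import Function using (_∘_)
open import Data.Nat as ℕ using (ℕ; zero; suc; _∸_; _≤_)
import Data.Nat.Properties as ℕ
open import Data.Fin as Fin using (Fin; zero; suc; combine; inject; fromℕ<; Fin′)
  renaming (_≤_ to _≤ᶠ_; _<_ to _<ᶠ_)
import Data.Fin.Properties as Fin
open import Data.List
  using (List; []; _∷_; length; filter; allFin; map; lookup; cartesianProductWith)
open import Data.List.Properties using (length-map; length-++; length-tabulate)
open import Data.List.Relation.Unary.All as All using (All; []; _∷_)
import Data.List.Relation.Unary.All.Properties as All
open import Data.List.Relation.Unary.AllPairs as AllPairs using (AllPairs; []; _∷_)
import Data.List.Relation.Unary.AllPairs.Properties as AllPairs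
open import Data.List.Relation.Unary.Any using (index)
open import Data.List.Relation.Unary.Any.Properties using (lookup-index)
import Data.List.Relation.Unary.Unique.Setoid as Setoid
open import Data.List.Relation.Unary.Unique.Propositional using (Unique)
import Data.List.Relation.Unary.Unique.Propositional.Properties as Unique
import Data.List.Relation.Unary.Unique.Setoid.Properties as Uniqueₛ
open import Data.List.Membership.Propositional using (_∈_)
open import Data.List.Membership.Propositional.Properties
  using (∈-filter⁺; ∈-filter⁻; ∈-map⁻; ∈-allFin; ∈-lookup)
open import Data.Product using (∃; _×_; _,_; proj₁; proj₂)
open import Relation.Nullary using (¬_; yes; no; contradiction)
open import Relation.Nullary.Decidable using (¬?; decidable-stable)
open import Relation.Unary using (Pred; Decidable)
open import Relation.Unary.Properties using (∁?)
open import Relation.Binary using (Setoid; DecidableEquality; tri<; tri≈; tri>)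
open import Relation.Binary.PropositionalEquality
open import Relation.Binary.PropositionalEquality.Properties using (subst-injective)
open import Algebra.Bundles using (CommutativeRing)

module _ {A : Set} {P : Pred A 0ℓ} (P? : Decidable P) where

  length-filter-+-∁ : ∀ xs → length (filter P? xs) ℕ.+ length (filter (∁? P?) xs) ≡ length xs
  length-filter-+-∁ [] = refl
  length-filter-+-∁ (x ∷ xs) with P? x
  ... | yes _ = cong suc (length-filter-+-∁ xs)
  ... | no _  = trans (ℕ.+-suc _ _) (cong suc (length-filter-+-∁ xs))

module _ {A : Set} where

  Unique-All≡⇒length≡1 : ∀ {xs : List A} {a} → Unique xs → All (_≡ a) xs → a ∈ xs → length xs ≡ 1
  Unique-All≡⇒length≡1 {_ ∷ []}    _               _                   _ = refl
  Unique-All≡⇒length≡1 {_ ∷ _ ∷ _} ((x≢y ∷ _) ∷ _) (refl ∷ refl ∷ _) _ = contradiction refl x≢y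

  lookup-injective : ∀ {xs : List A} {i j} → Unique xs → lookup xs i ≡ lookup xs j → i ≡ j
  lookup-injective {_ ∷ _} {zero}  {zero}  _         _ = refl
  lookup-injective {_ ∷ _} {zero}  {suc j} (x∉ ∷ _)  e = contradiction e (All.lookup x∉ (∈-lookup j))
  lookup-injective {_ ∷ _} {suc i} {zero}  (x∉ ∷ _)  e =
    contradiction (sym e) (All.lookup x∉ (∈-lookup i))
  lookup-injective {_ ∷ _} {suc i} {suc j} (_ ∷ xs!) e = cong suc (lookup-injective xs! e)

  All-AllPairs-map : ∀ {P : A → Set} {R S : A → A → Set} {xs} → All P xs → AllPairs R xs →
                     (∀ {x y} → P x → P y → R x y → S x y) → AllPairs S xs
  All-AllPairs-map []         []         f = []
  All-AllPairs-map (px ∷ pxs) (rx ∷ rxs) f =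
    All.zipWith (λ (py , rxy) → f px py rxy) (pxs , rx) ∷ All-AllPairs-map pxs rxs f

module _ {A : Set} (_≟_ : DecidableEquality A) where
  open import Data.List.Membership.DecPropositional _≟_ using (_∈?_)

  indexOf : (xs : List A) → Fin (length xs) → A → Fin (length xs)
  indexOf xs default x with x ∈? xs
  ... | yes x∈xs = index x∈xs
  ... | no _     = default

  lookup-indexOf : ∀ {xs} default {x} → x ∈ xs → lookup xs (indexOf xs default x) ≡ x
  lookup-indexOf {xs} default {x} x∈xs with x ∈? xs
  ... | yes x∈xs′ = sym (lookup-index x∈xs′)
  ... | no x∉xs   = contradiction x∈xs x∉xs

  indexOf-injective : ∀ {xs} default {x y} → x ∈ xs → y ∈ xs →
                      indexOf xs default x ≡ indexOf xs default y → x ≡ y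
  indexOf-injective {xs} default {x} {y} x∈xs y∈xs e = begin
    x                               ≡⟨ lookup-indexOf default x∈xs ⟨
    lookup xs (indexOf xs default x) ≡⟨ cong (lookup xs) e ⟩
    lookup xs (indexOf xs default y) ≡⟨ lookup-indexOf default y∈xs ⟩
    y                               ∎
    where open ≡-Reasoning

Unique⇒length≤ : ∀ {m} {xs : List (Fin m)} → Unique xs → length xs ≤ m
Unique⇒length≤ xs! = Fin.injective⇒≤ (lookup-injective xs!)

∀-Fin′⇒∀-< : ∀ {n} {i : Fin n} (P : Pred (Fin n) 0ℓ) →
             ((j : Fin′ i) → P (inject j)) → ∀ y → y <ᶠ i → P y
∀-Fin′⇒∀-< {i = i} P h y y<i = subst P inject-j≡y (h j)
  where
  j : Fin′ i
  j = fromℕ< y<i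
  inject-j≡y : inject j ≡ y
  inject-j≡y = Fin.toℕ-injective (trans (Fin.toℕ-inject j) (Fin.toℕ-fromℕ< y<i))

non-surjective⇒collision : ∀ {s} (f : Fin s → Fin s) (t : Fin s) → (∀ w → f w ≢ t) →
                           ∃ λ i → ∃ λ j → i ≢ j × f i ≡ f j
non-surjective⇒collision {suc s} f t t∉f
  with i , j , i<j , e ← Fin.pigeonhole ℕ.≤-refl (λ w → Fin.punchOut (t∉f w ∘ sym))
  = i , j , Fin.<⇒≢ i<j , Fin.punchOut-injective {i = t} _ _ e

∏-cong : ∀ {n} {f g : Fin n → ℕ} → (∀ i → f i ≡ g i) → ∏ f ≡ ∏ g
∏-cong {zero}  e = refl
∏-cong {suc n} e = cong₂ ℕ._*_ (e zero) (∏-cong (e ∘ suc))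

encode : ∀ {n} {g : Fin n → ℕ} → ((i : Fin n) → Fin (g i)) → Fin (∏ g)
encode {zero}  u = zero
encode {suc n} u = combine (u zero) (encode (u ∘ suc))

encode-injective : ∀ {n} {g : Fin n → ℕ} (u v : (i : Fin n) → Fin (g i)) →
                   encode u ≡ encode v → ∀ i → u i ≡ v i
encode-injective {suc n} u v e zero    = proj₁ (Fin.combine-injective (u zero) _ (v zero) _ e)
encode-injective {suc n} u v e (suc i) =
  encode-injective (u ∘ suc) (v ∘ suc) (proj₂ (Fin.combine-injective (u zero) _ (v zero) _ e)) i

module _ {n : ℕ} (F : Fin n → Set) where

  Π-setoid : Setoid 0ℓ 0ℓ
  Π-setoid = record
    { Carrier       = (i : Fin n) → F i
    ; _≈_           = λ f g → ∀ i → f i ≡ g i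
    ; isEquivalence = record
      { refl  = λ i → refl
      ; sym   = λ e i → sym (e i)
      ; trans = λ e e′ i → trans (e i) (e′ i)
      }
    }

cons : ∀ {n} {F : Fin (suc n) → Set} → F zero → ((i : Fin n) → F (suc i)) → (i : Fin (suc n)) → F i
cons a f zero    = a
cons a f (suc i) = f i

choices : ∀ {n} {F : Fin n → Set} → ((i : Fin n) → List (F i)) → List ((i : Fin n) → F i)
choices {zero}  ls = (λ ()) ∷ []
choices {suc n} ls = cartesianProductWith cons (ls zero) (choices (ls ∘ suc))

length-cartesianProductWith : ∀ {A B C : Set} (f : A → B → C) xs ys →
  length (cartesianProductWith f xs ys) ≡ length xs ℕ.* length ys
length-cartesianProductWith f []       ys = refl
length-cartesianProductWith f (x ∷ xs) ys = trans (length-++ (map (f x) ys))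
  (cong₂ ℕ._+_ (length-map (f x) ys) (length-cartesianProductWith f xs ys))

length-choices : ∀ {n} {F : Fin n → Set} (ls : (i : Fin n) → List (F i)) →
                 length (choices ls) ≡ ∏ (length ∘ ls)
length-choices {zero}  ls = refl
length-choices {suc n} {F} ls =
  trans (length-cartesianProductWith (cons {F = F}) (ls zero) (choices (ls ∘ suc)))
        (cong (length (ls zero) ℕ.*_) (length-choices (ls ∘ suc)))

choices-∈ : ∀ {n} {F : Fin n → Set} (ls : (i : Fin n) → List (F i)) →
            All (λ f → ∀ i → f i ∈ ls i) (choices ls)
choices-∈ {zero}  ls = (λ ()) ∷ []
choices-∈ {suc n} {F} ls =
  All.cartesianProductWith⁺ (setoid _) (setoid _) (cons {F = F}) (ls zero) (choices (ls ∘ suc))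
    λ a∈ f∈ → λ { zero → a∈ ; (suc i) → All.lookup (choices-∈ (ls ∘ suc)) f∈ i }

choices-unique : ∀ {n} {F : Fin n → Set} (ls : (i : Fin n) → List (F i)) →
                 (∀ i → Unique (ls i)) → Setoid.Unique (Π-setoid F) (choices ls)
choices-unique {zero}  ls ls! = [] ∷ []
choices-unique {suc n} {F} ls ls! =
  Uniqueₛ.cartesianProductWith⁺ (setoid _) (Π-setoid (F ∘ suc)) (Π-setoid F) cons
    (λ e → e zero , e ∘ suc) (ls! zero) (choices-unique (ls ∘ suc) (ls! ∘ suc))

module _ {A : Set} {V : A → Set} {E : A → A → Set} where

  clique-length≤colours : ∀ {m} {c : A → Fin m} → IsProperColoring V E c →
                          ∀ {xs} → IsClique V E xs → length xs ≤ m
  clique-length≤colours {c = c} proper {xs} (Vxs , Exs) = subst (_≤ _) (length-map c xs)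
    (Unique⇒length≤ (AllPairs.map⁺ (All-AllPairs-map Vxs Exs (proper _ _))))

  clique∧colouring⇒numbers : ∀ {k xs} {c : A → Fin k} → IsClique V E xs → length xs ≡ k →
                             IsProperColoring V E c → IsCliqueNumber V E k × IsChromaticNumber V E k
  clique∧colouring⇒numbers {c = c} clique refl proper =
      ((_ , clique , refl) , λ _ clique′ → clique-length≤colours proper clique′)
    , ((c , proper)        , λ _ _ proper′ → clique-length≤colours proper′ clique)

module RingProperties (R : FinCommRing) where

  commutativeRing : CommutativeRing 0ℓ 0ℓ
  commutativeRing = record { isCommutativeRing = isCommutativeRing R }

  open CommutativeRing commutativeRing public using (Carrier; _+_; _*_; -_; _-_; 0#; 1#)
  open CommutativeRing commutativeRing
    using ( +-assoc; *-assoc; *-comm; *-identityˡ; *-identityʳ; zeroˡ; -‿inverseʳ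
          ; ring; +-group; +-abelianGroup)
  open import Algebra.Properties.Ring ring using (-‿distribʳ-*; x[y-z]≈xy-xz; [y-z]x≈yx-zx)
  open import Algebra.Properties.AbelianGroup +-abelianGroup using (⁻¹-anti-homo‿-)
  open import Algebra.Properties.Group +-group
    using (x∙y⁻¹≈ε⇒x≈y; //-rightDividesˡ; ∙-cancelˡ)

  infix 4 _≡_mod𝔪

  _≡_mod𝔪 : Carrier → Carrier → Set
  x ≡ y mod𝔪 = InMax R (x - y)

  1-unit : IsUnit R 1#
  1-unit = 1# , *-identityʳ 1#

  +-cancelˡ : ∀ {o x y} → o + x ≡ o + y → x ≡ y
  +-cancelˡ = ∙-cancelˡ _ _ _

  unit-* : ∀ {a b} → IsUnit R a → IsUnit R b → IsUnit R (a * b)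
  unit-* {a} {b} (a⁻¹ , aa⁻¹≡1) (b⁻¹ , bb⁻¹≡1) = b⁻¹ * a⁻¹ , (begin
    a * b * (b⁻¹ * a⁻¹)   ≡⟨ *-assoc a b _ ⟩
    a * (b * (b⁻¹ * a⁻¹)) ≡⟨ cong (a *_) (*-assoc b b⁻¹ a⁻¹) ⟨
    a * (b * b⁻¹ * a⁻¹)   ≡⟨ cong (λ c → a * (c * a⁻¹)) bb⁻¹≡1 ⟩
    a * (1# * a⁻¹)        ≡⟨ cong (a *_) (*-identityˡ a⁻¹) ⟩
    a * a⁻¹               ≡⟨ aa⁻¹≡1 ⟩
    1#                    ∎)
    where open ≡-Reasoning

  inMax-*ʳ : ∀ {a} b → InMax R a → InMax R (a * b)
  inMax-*ʳ {a} b a∈𝔪 (c , abc≡1) = a∈𝔪 (b * c , trans (sym (*-assoc a b c)) abc≡1)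

  inMax-‿ : ∀ {a} → InMax R a → InMax R (- a)
  inMax-‿ {a} a∈𝔪 = subst (InMax R) (trans (sym (-‿distribʳ-* a 1#)) (cong -_ (*-identityʳ a)))
    (inMax-*ʳ (- 1#) a∈𝔪)

  unit-cancelʳ : ∀ {t x y} → IsUnit R t → x * t ≡ y * t → x ≡ y
  unit-cancelʳ {t} {x} {y} (t⁻¹ , tt⁻¹≡1) xt≡yt = begin
    x             ≡⟨ *-identityʳ x ⟨
    x * 1#        ≡⟨ cong (x *_) tt⁻¹≡1 ⟨
    x * (t * t⁻¹) ≡⟨ *-assoc x t t⁻¹ ⟨
    x * t * t⁻¹   ≡⟨ cong (_* t⁻¹) xt≡yt ⟩
    y * t * t⁻¹   ≡⟨ *-assoc y t t⁻¹ ⟩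
    y * (t * t⁻¹) ≡⟨ cong (y *_) tt⁻¹≡1 ⟩
    y * 1#        ≡⟨ *-identityʳ y ⟩
    y             ∎
    where open ≡-Reasoning

  unit-*-≡0 : ∀ {u w} → IsUnit R u → u * w ≡ 0# → w ≡ 0#
  unit-*-≡0 {u} {w} u-unit uw≡0 =
    unit-cancelʳ u-unit (trans (*-comm w u) (trans uw≡0 (sym (zeroˡ u))))

  -- multiplication by z misses 1, so on a finite ring it identifies two elements i ≠ j
  inMax⇒zeroDivisor : ∀ {z} → InMax R z → ∃ λ w → w ≢ 0# × z * w ≡ 0#
  inMax⇒zeroDivisor {z} z∈𝔪 with Fin.any? (λ w → z * w Fin.≟ 1#)
  ... | yes z⁻¹ = contradiction z⁻¹ z∈𝔪
  ... | no ¬z⁻¹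
    with i , j , i≢j , zi≡zj ← non-surjective⇒collision (z *_) 1# (λ w e → ¬z⁻¹ (w , e))
    = i - j , i≢j ∘ x∙y⁻¹≈ε⇒x≈y i j , (begin
      z * (i - j)   ≡⟨ x[y-z]≈xy-xz z i j ⟩
      z * i - z * j ≡⟨ cong (_- z * j) zi≡zj ⟩
      z * j - z * j ≡⟨ -‿inverseʳ (z * j) ⟩
      0#            ∎)
    where open ≡-Reasoning

  [x-y]+[y-z]≡x-z : ∀ x y z → (x - y) + (y - z) ≡ x - z
  [x-y]+[y-z]≡x-z x y z = trans (sym (+-assoc (x - y) y (- z))) (cong (_- z) (//-rightDividesˡ y x))

  ≡mod𝔪-sym : ∀ {x y} → x ≡ y mod𝔪 → y ≡ x mod𝔪
  ≡mod𝔪-sym {x} {y} x≡y = subst (InMax R) (⁻¹-anti-homo‿- x y) (inMax-‿ x≡y)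

  cancel-≡mod𝔪 : ∀ {x y t t′} → x * t ≡ y * t′ → x ≡ y mod𝔪 → IsUnit R y → t ≡ t′ mod𝔪
  cancel-≡mod𝔪 {x} {y} {t} {t′} xt≡yt′ x≡y y-unit t-t′-unit =
    inMax-*ʳ t (≡mod𝔪-sym x≡y) (subst (IsUnit R) y[t-t′]≡[y-x]t (unit-* y-unit t-t′-unit))
    where
    open ≡-Reasoning
    y[t-t′]≡[y-x]t : y * (t - t′) ≡ (y - x) * t
    y[t-t′]≡[y-x]t = begin
      y * (t - t′)  ≡⟨ x[y-z]≈xy-xz y t t′ ⟩
      y * t - y * t′ ≡⟨ cong (λ c → y * t - c) xt≡yt′ ⟨
      y * t - x * t  ≡⟨ [y-z]x≈yx-zx t y x ⟨
      (y - x) * t    ∎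

module LocalRingProperties (R : FinCommRing) (local : IsLocal R) where

  open RingProperties R public
  open CommutativeRing commutativeRing using (+-comm; +-identityˡ; zeroˡ; -‿inverseʳ; +-group)
  open import Algebra.Properties.Group +-group using (//-rightDividesˡ; //-rightDividesʳ)

  0∈𝔪 : InMax R 0#
  0∈𝔪 (c , 0c≡1) = proj₁ local (trans (sym 0c≡1) (zeroˡ c))

  inMax-+ : ∀ {a b} → InMax R a → InMax R b → InMax R (a + b)
  inMax-+ = proj₂ local _ _

  ≡mod𝔪-refl : ∀ {x} → x ≡ x mod𝔪
  ≡mod𝔪-refl {x} = subst (InMax R) (sym (-‿inverseʳ x)) 0∈𝔪

  ≡mod𝔪-trans : ∀ {x y z} → x ≡ y mod𝔪 → y ≡ z mod𝔪 → x ≡ z mod𝔪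
  ≡mod𝔪-trans {x} {y} {z} x≡y y≡z = subst (InMax R) ([x-y]+[y-z]≡x-z x y z) (inMax-+ x≡y y≡z)

  inMax-resp-≡mod𝔪 : ∀ {x y} → x ≡ y mod𝔪 → InMax R x → InMax R y
  inMax-resp-≡mod𝔪 {x} {y} x≡y x∈𝔪 =
    subst (InMax R) (//-rightDividesˡ x y) (inMax-+ (≡mod𝔪-sym x≡y) x∈𝔪)

  unit-resp-≡mod𝔪 : ∀ {x y} → x ≡ y mod𝔪 → IsUnit R x → IsUnit R y
  unit-resp-≡mod𝔪 {x} {y} x≡y x-unit =
    decidable-stable (isUnit? R y) (λ y∈𝔪 → inMax-resp-≡mod𝔪 (≡mod𝔪-sym x≡y) y∈𝔪 x-unit)

  inMax⇒≡0mod𝔪 : ∀ {x} → InMax R x → x ≡ 0# mod𝔪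
  inMax⇒≡0mod𝔪 {x} x∈𝔪 = ≡mod𝔪-sym (subst (InMax R) (sym (+-identityˡ (- x))) (inMax-‿ x∈𝔪))

  +inMax-≡mod𝔪 : ∀ x {m} → InMax R m → x + m ≡ x mod𝔪
  +inMax-≡mod𝔪 x {m} =
    subst (InMax R) (sym (trans (cong (_- x) (+-comm x m)) (//-rightDividesʳ x m)))

  1+inMax-unit : ∀ {m} → InMax R m → IsUnit R (1# + m)
  1+inMax-unit m∈𝔪 = unit-resp-≡mod𝔪 (≡mod𝔪-sym (+inMax-≡mod𝔪 1# m∈𝔪)) 1-unit

  private
    least-in-class : ∀ x → ∃ λ y → ¬ ¬ x ≡ y mod𝔪 × ((j : Fin′ y) → ¬ x ≡ inject j mod𝔪)
    least-in-class x = Fin.¬∀⟶∃¬-smallest (size R) (λ y → ¬ x ≡ y mod𝔪)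
      (λ y → ¬? (inMax? R (x - y))) (λ h → h x ≡mod𝔪-refl)

  rep : Carrier → Carrier
  rep x = proj₁ (least-in-class x)

  ≡mod𝔪-rep : ∀ x → x ≡ rep x mod𝔪
  ≡mod𝔪-rep x x-rep-unit = proj₁ (proj₂ (least-in-class x)) (λ x≡rep → x≡rep x-rep-unit)

  rep-leastRep : ∀ x → LeastRep R (rep x)
  rep-leastRep x y y<rep rep≡y = ∀-Fin′⇒∀-< (λ y → ¬ x ≡ y mod𝔪) (proj₂ (proj₂ (least-in-class x)))
    y y<rep (≡mod𝔪-trans (≡mod𝔪-rep x) rep≡y)

  leastRep-unique : ∀ {r r′} → LeastRep R r → LeastRep R r′ → r ≡ r′ mod𝔪 → r ≡ r′
  leastRep-unique {r} {r′} least least′ r≡r′ with Fin.<-cmp r r′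
  ... | tri< r<r′ _ _ = contradiction (≡mod𝔪-sym r≡r′) (least′ r r<r′)
  ... | tri≈ _ r≡r′ _ = r≡r′
  ... | tri> _ _ r′<r = contradiction r≡r′ (least r′ r′<r)

  rep-cong : ∀ {x y} → x ≡ y mod𝔪 → rep x ≡ rep y
  rep-cong {x} {y} x≡y = leastRep-unique (rep-leastRep x) (rep-leastRep y)
    (≡mod𝔪-trans (≡mod𝔪-sym (≡mod𝔪-rep x)) (≡mod𝔪-trans x≡y (≡mod𝔪-rep y)))

  offset : Carrier → Carrier
  offset x = x - rep x

  offset-injective : ∀ {x y} → x ≡ y mod𝔪 → offset x ≡ offset y → x ≡ y
  offset-injective {x} {y} x≡y offset-x≡offset-y = begin
    x                  ≡⟨ //-rightDividesˡ (rep x) x ⟨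
    offset x + rep x   ≡⟨ cong₂ _+_ offset-x≡offset-y (rep-cong x≡y) ⟩
    offset y + rep y   ≡⟨ //-rightDividesˡ (rep y) y ⟩
    y                  ∎
    where open ≡-Reasoning

  maxIdeal units leastReps unitReps : List Carrier
  maxIdeal  = filter (inMax? R) (allFin (size R))
  units     = filter (isUnit? R) (allFin (size R))
  leastReps = filter (leastRep? R) (allFin (size R))
  unitReps  = filter (isUnit? R) leastReps

  length-units : length units ≡ size R ∸ maxCard R
  length-units = begin
    length units
      ≡⟨ ℕ.m+n∸n≡m (length units) (maxCard R) ⟨
    length units ℕ.+ maxCard R ∸ maxCard R
      ≡⟨ cong (_∸ maxCard R) (length-filter-+-∁ (isUnit? R) (allFin (size R))) ⟩
    length (allFin (size R)) ∸ maxCard R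
      ≡⟨ cong (_∸ maxCard R) (length-tabulate (λ x → x)) ⟩
    size R ∸ maxCard R ∎
    where open ≡-Reasoning

  -- the only residue class of non-units is 𝔪 itself, the class of 0
  length-nonunitReps : length (filter (∁? (isUnit? R)) leastReps) ≡ 1
  length-nonunitReps = Unique-All≡⇒length≡1
    (Unique.filter⁺ _ (Unique.filter⁺ _ (Unique.allFin⁺ _)))
    (All.map (λ (r∈𝔪 , least) → nonunitRep≡rep0 least r∈𝔪)
       (All.zip (All.all-filter _ leastReps , All.filter⁺ _ (All.all-filter (leastRep? R) (allFin _)))))
    (∈-filter⁺ _ (∈-filter⁺ (leastRep? R) (∈-allFin _) (rep-leastRep 0#))
       (inMax-resp-≡mod𝔪 (≡mod𝔪-rep 0#) 0∈𝔪))
    where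
    nonunitRep≡rep0 : ∀ {r} → LeastRep R r → InMax R r → r ≡ rep 0#
    nonunitRep≡rep0 {r} least r∈𝔪 =
      leastRep-unique least (rep-leastRep 0#) (≡mod𝔪-trans (inMax⇒≡0mod𝔪 r∈𝔪) (≡mod𝔪-rep 0#))

  residueCard≡1+length-unitReps : residueCard R ≡ suc (length unitReps)
  residueCard≡1+length-unitReps = begin
    residueCard R
      ≡⟨ length-filter-+-∁ (isUnit? R) leastReps ⟨
    length unitReps ℕ.+ length (filter (∁? (isUnit? R)) leastReps)
      ≡⟨ cong (length unitReps ℕ.+_) length-nonunitReps ⟩
    length unitReps ℕ.+ 1
      ≡⟨ ℕ.+-comm (length unitReps) 1 ⟩
    suc (length unitReps) ∎
    where open ≡-Reasoning

  ∈-units : ∀ {x} → IsUnit R x → x ∈ units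
  ∈-units = ∈-filter⁺ (isUnit? R) (∈-allFin _)

  ∈-maxIdeal : ∀ {x} → InMax R x → x ∈ maxIdeal
  ∈-maxIdeal = ∈-filter⁺ (inMax? R) (∈-allFin _)

  rep∈unitReps : ∀ {x} → IsUnit R x → rep x ∈ unitReps
  rep∈unitReps {x} x-unit =
    ∈-filter⁺ (isUnit? R) (∈-filter⁺ (leastRep? R) (∈-allFin _) (rep-leastRep x))
      (unit-resp-≡mod𝔪 (≡mod𝔪-rep x) x-unit)

  unitIndex : Carrier → Fin (length units)
  unitIndex = indexOf Fin._≟_ units (index (∈-units 1-unit))

  unitIndex-injective : ∀ {x y} → IsUnit R x → IsUnit R y → unitIndex x ≡ unitIndex y → x ≡ y
  unitIndex-injective x-unit y-unit = indexOf-injective Fin._≟_ _ (∈-units x-unit) (∈-units y-unit)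

  offsetIndex : Carrier → Fin (maxCard R)
  offsetIndex x = indexOf Fin._≟_ maxIdeal (index (∈-maxIdeal 0∈𝔪)) (offset x)

  offsetIndex-injective : ∀ {x y} → x ≡ y mod𝔪 → offsetIndex x ≡ offsetIndex y → x ≡ y
  offsetIndex-injective {x} {y} x≡y e = offset-injective x≡y
    (indexOf-injective Fin._≟_ _ (∈-maxIdeal (≡mod𝔪-rep x)) (∈-maxIdeal (≡mod𝔪-rep y)) e)

  residueIndex : Carrier → Fin (length unitReps)
  residueIndex x = indexOf Fin._≟_ unitReps (index (rep∈unitReps 1-unit)) (rep x)

  residueIndex-injective : ∀ {x y} → IsUnit R x → IsUnit R y →
                           residueIndex x ≡ residueIndex y → x ≡ y mod𝔪
  residueIndex-injective {x} {y} x-unit y-unit e = ≡mod𝔪-trans (≡mod𝔪-rep x)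
    (subst (_≡ y mod𝔪) (sym rep-x≡rep-y) (≡mod𝔪-sym (≡mod𝔪-rep y)))
    where
    rep-x≡rep-y : rep x ≡ rep y
    rep-x≡rep-y = indexOf-injective Fin._≟_ _ (rep∈unitReps x-unit) (rep∈unitReps y-unit) e

  unitRep : Fin (length unitReps) → Carrier
  unitRep = lookup unitReps

  unitRep-unit : ∀ i → IsUnit R (unitRep i)
  unitRep-unit i = proj₂ (∈-filter⁻ (isUnit? R) {xs = leastReps} (∈-lookup i))

  unitRep-injective : ∀ {i j} → unitRep i ≡ unitRep j mod𝔪 → i ≡ j
  unitRep-injective {i} {j} e = lookup-injective
    (Unique.filter⁺ _ (Unique.filter⁺ _ (Unique.allFin⁺ _)))
    (leastRep-unique (unitRep-leastRep i) (unitRep-leastRep j) e)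
    where
    unitRep-leastRep : ∀ i → LeastRep R (unitRep i)
    unitRep-leastRep i = proj₂ (∈-filter⁻ (leastRep? R) {xs = allFin _}
      (proj₁ (∈-filter⁻ (isUnit? R) {xs = leastReps} (∈-lookup i))))

module ResidueEmbedding (R S : FinCommRing) (R-local : IsLocal R) (S-local : IsLocal S)
                        (R≤S : residueCard R ≤ residueCard S) where

  private
    module R = LocalRingProperties R R-local
    module S = LocalRingProperties S S-local

    unitReps≤ : length R.unitReps ≤ length S.unitReps
    unitReps≤ = ℕ.s≤s⁻¹
      (subst₂ _≤_ R.residueCard≡1+length-unitReps S.residueCard≡1+length-unitReps R≤S)

  embed : Fin (size R) → Fin (size S)
  embed x = S.unitRep (Fin.inject≤ (R.residueIndex x) unitReps≤)

  embed-unit : ∀ x → IsUnit S (embed x)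
  embed-unit x = S.unitRep-unit _

  embed-reflects-≡mod𝔪 : ∀ {x y} → IsUnit R x → IsUnit R y → embed x S.≡ embed y mod𝔪 → x R.≡ y mod𝔪
  embed-reflects-≡mod𝔪 x-unit y-unit e = R.residueIndex-injective x-unit y-unit
    (Fin.inject≤-injective unitReps≤ unitReps≤ _ _ (S.unitRep-injective e))

module ProductProperties {n : ℕ} (R : Fin n → FinCommRing) where

  open Product R
  private
    module Rᵢ (i : Fin n) = RingProperties (R i)

  allUnits⇒Reg : ∀ {x} → (∀ i → IsUnit (R i) (x i)) → Reg x
  allUnits⇒Reg units (y , y≉0 , xy≈0) = y≉0 (λ i → Rᵢ.unit-*-≡0 i (units i) (xy≈0 i))

  basis : (j : Fin n) → Fin (size (R j)) → Carrier
  basis j w i with i Fin.≟ j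
  ... | yes refl = w
  ... | no _     = 0ᴾ i

  inMax⇒ZeroDiv : ∀ {x} j → InMax (R j) (x j) → ZeroDiv x
  inMax⇒ZeroDiv {x} j xⱼ∈𝔪 with w , w≢0 , xⱼw≡0 ← Rᵢ.inMax⇒zeroDivisor j xⱼ∈𝔪 =
    basis j w , (λ e → w≢0 (subst (_≡ 0ᴾ j) basis-at (e j))) , x*basis≈0
    where
    basis-at : basis j w j ≡ w
    basis-at with j Fin.≟ j
    ... | yes refl = refl
    ... | no j≢j   = contradiction refl j≢j
    x*basis≈0 : (x *ᴾ basis j w) ≈ 0ᴾ
    x*basis≈0 i with i Fin.≟ j
    ... | yes refl = xⱼw≡0
    ... | no _     = CommutativeRing.zeroʳ (Rᵢ.commutativeRing i) (x i)

  Reg⇒allUnits : ∀ {x} → Reg x → ∀ i → IsUnit (R i) (x i)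
  Reg⇒allUnits reg i = decidable-stable (isUnit? (R i) _) (reg ∘ inMax⇒ZeroDiv i)

  ZeroDiv⇒inMax : ∀ {x} → ZeroDiv x → ∃ λ j → InMax (R j) (x j)
  ZeroDiv⇒inMax {x} zd = decidable-stable (Fin.any? λ j → inMax? (R j) (x j))
    λ ¬∃ → allUnits⇒Reg (λ i → decidable-stable (isUnit? (R i) _) (¬∃ ∘ (i ,_))) zd

module RegularCayleyGraph (n : ℕ) (R : Fin (suc n) → FinCommRing) (local : ∀ i → IsLocal (R i))
       (residue-mono : ∀ i j → i ≤ᶠ j → residueCard (R i) ≤ residueCard (R j)) where

  open Product R
  open ProductProperties R
  private
    module R₀ = LocalRingProperties (R zero) (local zero)
    module Rᵢ (i : Fin (suc n)) = LocalRingProperties (R i) (local i)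
    module τ (i : Fin n) = ResidueEmbedding (R zero) (R (suc i)) (local zero) (local (suc i))
                             (residue-mono zero (suc i) ℕ.z≤n)

  cliqueSize : ℕ
  cliqueSize = maxCard (R zero) ℕ.* ∏ (λ (i : Fin n) → size (R (suc i)) ∸ maxCard (R (suc i)))

  candidates : (i : Fin (suc n)) → List (Fin (size (R i)))
  candidates zero    = map (R₀.1# R₀.+_) R₀.maxIdeal
  candidates (suc i) = Rᵢ.units (suc i)

  candidates-unique : ∀ i → Unique (candidates i)
  candidates-unique zero    = Unique.map⁺ R₀.+-cancelˡ (Unique.filter⁺ _ (Unique.allFin⁺ _))
  candidates-unique (suc i) = Unique.filter⁺ _ (Unique.allFin⁺ _)

  candidate₀-form : ∀ {a} → a ∈ candidates zero → ∃ λ m → InMax (R zero) m × a ≡ R₀.1# R₀.+ m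
  candidate₀-form a∈ with m , m∈ , a≡1+m ← ∈-map⁻ _ a∈ =
    m , proj₂ (∈-filter⁻ (inMax? (R zero)) {xs = allFin _} m∈) , a≡1+m

  candidate-unit : ∀ i {a} → a ∈ candidates i → IsUnit (R i) a
  candidate-unit zero    a∈ with m , m∈𝔪 , refl ← candidate₀-form a∈ = R₀.1+inMax-unit m∈𝔪
  candidate-unit (suc i) a∈ = proj₂ (∈-filter⁻ (isUnit? (R (suc i))) {xs = allFin _} a∈)

  candidates₀-≡mod𝔪 : ∀ {a b} → a ∈ candidates zero → b ∈ candidates zero → a R₀.≡ b mod𝔪
  candidates₀-≡mod𝔪 a∈ b∈
    with m , m∈𝔪 , refl ← candidate₀-form a∈ | m′ , m′∈𝔪 , refl ← candidate₀-form b∈ = R₀.≡mod𝔪-trans (R₀.+inMax-≡mod𝔪 R₀.1# m∈𝔪) (R₀.≡mod𝔪-sym (R₀.+inMax-≡mod𝔪 R₀.1# m′∈𝔪))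

  clique : List Carrier
  clique = choices candidates

  length-clique : length clique ≡ cliqueSize
  length-clique = trans (length-choices candidates)
    (cong₂ ℕ._*_ (length-map _ R₀.maxIdeal) (∏-cong (λ i → Rᵢ.length-units (suc i))))

  clique-isClique : IsClique Reg Adj clique
  clique-isClique =
      All.map (λ f∈ → allUnits⇒Reg (λ i → candidate-unit i (f∈ i))) (choices-∈ candidates)
    , All-AllPairs-map (choices-∈ candidates) (choices-unique candidates candidates-unique)
        (λ f∈ g∈ f≉g → f≉g , inMax⇒ZeroDiv zero (candidates₀-≡mod𝔪 (f∈ zero) (g∈ zero)))

  rescaled : Carrier → (i : Fin n) → Fin (size (R (suc i)))
  rescaled x i = _*ᴿ_ (R (suc i)) (x (suc i)) (τ.embed i (x zero))

  colourCount≡cliqueSize : maxCard (R zero) ℕ.* ∏ (λ i → length (Rᵢ.units (suc i))) ≡ cliqueSize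
  colourCount≡cliqueSize = cong (maxCard (R zero) ℕ.*_) (∏-cong (λ i → Rᵢ.length-units (suc i)))

  unitIndices : Carrier → (i : Fin n) → Fin (length (Rᵢ.units (suc i)))
  unitIndices x i = Rᵢ.unitIndex (suc i) (rescaled x i)

  rawColour : Carrier → Fin (maxCard (R zero) ℕ.* ∏ (λ i → length (Rᵢ.units (suc i))))
  rawColour x = combine (R₀.offsetIndex (x zero)) (encode (unitIndices x))

  colour : Carrier → Fin cliqueSize
  colour x = subst Fin colourCount≡cliqueSize (rawColour x)

  colour-components : ∀ {x y} → colour x ≡ colour y →
                      R₀.offsetIndex (x zero) ≡ R₀.offsetIndex (y zero)
                      × (∀ i → unitIndices x i ≡ unitIndices y i)
  colour-components {x} {y} colours≡ =
    proj₁ components≡ , encode-injective (unitIndices x) (unitIndices y) (proj₂ components≡)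
    where
    components≡ : R₀.offsetIndex (x zero) ≡ R₀.offsetIndex (y zero)
                  × encode (unitIndices x) ≡ encode (unitIndices y)
    components≡ = Fin.combine-injective (R₀.offsetIndex (x zero)) (encode (unitIndices x))
      (R₀.offsetIndex (y zero)) (encode (unitIndices y))
      (subst-injective colourCount≡cliqueSize colours≡)

  colour-proper : IsProperColoring Reg Adj colour
  colour-proper x y x-reg y-reg (x≉y , x-y∈Z) colours≡ = x≉y x≈y
    where
    x-units : ∀ i → IsUnit (R i) (x i)
    x-units = Reg⇒allUnits x-reg
    y-units : ∀ i → IsUnit (R i) (y i)
    y-units = Reg⇒allUnits y-reg

    rescaled≡ : ∀ i → rescaled x i ≡ rescaled y i
    rescaled≡ i = Rᵢ.unitIndex-injective (suc i)
      (Rᵢ.unit-* (suc i) (x-units (suc i)) (τ.embed-unit i (x zero)))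
      (Rᵢ.unit-* (suc i) (y-units (suc i)) (τ.embed-unit i (y zero)))
      (proj₂ (colour-components {x} {y} colours≡) i)

    -- x − y is a non-unit in some coordinate; in coordinate i + 1 equal rescaled values turn this
    -- into τᵢ(x₀) ≡ τᵢ(y₀), which τᵢ reflects
    x₀≡y₀mod𝔪 : x zero R₀.≡ y zero mod𝔪
    x₀≡y₀mod𝔪 = from-coordinate (ZeroDiv⇒inMax x-y∈Z)
      where
      from-coordinate : (∃ λ j → InMax (R j) ((x -ᴾ y) j)) → x zero R₀.≡ y zero mod𝔪
      from-coordinate (zero  , x₀≡y₀) = x₀≡y₀
      from-coordinate (suc i , xᵢ≡yᵢ) = τ.embed-reflects-≡mod𝔪 i (x-units zero) (y-units zero)
        (Rᵢ.cancel-≡mod𝔪 (suc i) (rescaled≡ i) xᵢ≡yᵢ (y-units (suc i)))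

    x₀≡y₀ : x zero ≡ y zero
    x₀≡y₀ = R₀.offsetIndex-injective x₀≡y₀mod𝔪 (proj₁ (colour-components {x} {y} colours≡))

    x≈y : x ≈ y
    x≈y zero    = x₀≡y₀
    x≈y (suc i) = Rᵢ.unit-cancelʳ (suc i) (τ.embed-unit i (y zero))
      (trans (cong (λ z → _*ᴿ_ (R (suc i)) (x (suc i)) (τ.embed i z)) (sym x₀≡y₀)) (rescaled≡ i))

open import Data.Nat using (_*_)

mainTheorem5 : (n : ℕ) (R : Fin (suc n) → FinCommRing)
    → (∀ i → IsLocal (R i))
    → (∀ i j → i ≤ᶠ j → residueCard (R i) ≤ residueCard (R j))
    → IsCliqueNumber (Product.Reg R) (Product.Adj R)
        (maxCard (R zero) * ∏ (λ (i : Fin n) → size (R (suc i)) ∸ maxCard (R (suc i))))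
      × IsChromaticNumber (Product.Reg R) (Product.Adj R)
        (maxCard (R zero) * ∏ (λ (i : Fin n) → size (R (suc i)) ∸ maxCard (R (suc i))))
mainTheorem5 n R local residue-mono =
  clique∧colouring⇒numbers clique-isClique length-clique colour-proper
  where open RegularCayleyGraph n R local residue-mono
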